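{- Let $p>3$ be a prime, $s$ a positive integer and $u_0,u_1,\dots,u_s\in\{0,1,p-2,p-1\}$. Let $v=\sum_{j=1}^{s}(2u_j-u_{j-1})p^{j-1}$ and suppose $v\neq p^s-1$. Then there exists $\delta\in\{ -1,0,1\}$ such that $v+\delta p^s=\sum_{j=1}^s\gamma_jp^{j-1}$ with $\gamma_1,\dots,\gamma_s\in\{0,\dots,p-1\}$ and $0<u_s+\delta+1\le p-1$. Furthermore, if $u_s=1$, $\delta=1$ and $p>5$, then there exists an index $j\in\{1,\dots,s\}$ such that $\gamma_j\notin\{0,1,p-2,p-1\}$. -}

module Defs where

open import Data.Nat as ℕ using (ℕ; zero; suc; _∸_)
open import Data.Integer as ℤ using (ℤ; +_; -[1+_]; _+_; _-_; _*_; _^_)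
open import Data.Fin using (Fin; zero; suc; inject₁; fromℕ; toℕ)
open import Data.Sum using (_⊎_)
open import Relation.Binary.PropositionalEquality using (_≡_)

Σ< : (n : ℕ) → (Fin n → ℤ) → ℤ
Σ< zero    f = + 0
Σ< (suc n) f = f zero + Σ< n (λ i → f (suc i))

Special : ℕ → ℕ → Set
Special p x = x ≡ 0 ⊎ x ≡ 1 ⊎ x ≡ p ∸ 2 ⊎ x ≡ p ∸ 1

Sign : ℤ → Set
Sign δ = δ ≡ ℤ.-1ℤ ⊎ δ ≡ + 0 ⊎ δ ≡ + 1

-- u : Fin (suc s) → ℕ encodes u_0,…,u_s (u_k = u k).
-- v = Σ_{j=1}^{s} (2 u_j - u_{j-1}) p^{j-1}; with i = j-1 ∈ {0,…,s-1}:
vOf : (p s : ℕ) → (Fin (suc s) → ℕ) → ℤ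
vOf p s u = Σ< s (λ i → (+ 2 * + u (suc i) - + u (inject₁ i)) * (+ p) ^ toℕ i)

-- Σ_{j=1}^{s} γ_j p^{j-1}, with γ : Fin s → ℕ, γ i = γ_{i+1}
digitsVal : (p s : ℕ) → (Fin s → ℕ) → ℤ
digitsVal p s γ = Σ< s (λ i → + γ i * (+ p) ^ toℕ i)

{-# OPTIONS --safe #-}
module Submission where

-- Since u i ≤ p - 1, v + p ^ s = 1 + Σ c i * p ^ i with column values
-- c i = (p - 1 - u i) + 2 * u (i + 1) ∈ [0, 3p - 3].  Adding the columns up from the bottom,
-- starting with carry 1, gives base-p digits γ and a final carry q with
-- v + p ^ s = Σ γ i * p ^ i + q * p ^ s, so δ = 1 - q.  The carry entering column i together
-- with u i forms a finite state, and the constraints on it (Admissible) give δ ∈ {-1, 0, 1}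
-- and the range of u s + δ + 1, except at the state (1, p - 1).  That state can only be
-- entered from itself, so reaching it at the end forces every u i = p - 1, i.e. v = p ^ s - 1.
-- For p ≥ 7 the states (0, 1) and (2, p - 2) can only be entered with a special digit from
-- each other, and the initial state (1, u 0) is neither; so ending in (0, 1), which is the case
-- u s = 1 and δ = 1, requires a non-special digit on the way.

open import Defs
open import Data.Fin using (Fin; zero; suc; inject₁; fromℕ; toℕ)
open import Data.Product using (∃; _×_; _,_)
open import Data.Sum using (_⊎_; inj₁; inj₂)
open import Data.List using (_∷_; [])
open import Function using (_∘_)
open import Relation.Binary.PropositionalEquality
open import Relation.Nullary using (¬_; Dec; yes; no; contradiction)
open import Relation.Nullary.Decidable using (_⊎-dec_)

module Normalisation where
  open import Data.Nat using (ℕ; zero; suc; NonZero; _+_; _*_; _∸_; _<_)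
  open import Data.Nat.DivMod using (_/_; _%_; m%n<n)

  module _ (p : ℕ) .{{_ : NonZero p}} where

    finalCarry : ∀ {s} → ℕ → (Fin s → ℕ) → ℕ
    finalCarry {zero}  q c = q
    finalCarry {suc s} q c = finalCarry ((q + c zero) / p) (c ∘ suc)

    normalDigits : ∀ {s} → ℕ → (Fin s → ℕ) → Fin s → ℕ
    normalDigits q c zero    = (q + c zero) % p
    normalDigits q c (suc i) = normalDigits ((q + c zero) / p) (c ∘ suc) i

    normalDigits<p : ∀ {s} q (c : Fin s → ℕ) i → normalDigits q c i < p
    normalDigits<p q c zero    = m%n<n (q + c zero) p
    normalDigits<p q c (suc i) = normalDigits<p _ (c ∘ suc) i

  -- The coefficient of p ^ i in v + (p ^ s - 1) = Σ ((p - 1) - u i + 2 * u (i + 1)) * p ^ i.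
  column : ℕ → ℕ → ℕ → ℕ
  column p b a = p ∸ 1 ∸ b + 2 * a

  columns : ∀ p {s} → (Fin (suc s) → ℕ) → Fin s → ℕ
  columns p u i = column p (u (inject₁ i)) (u (suc i))

  nextCarry nextDigit : (p : ℕ) .{{_ : NonZero p}} → ℕ → ℕ → ℕ → ℕ
  nextCarry p q b a = (q + column p b a) / p
  nextDigit p q b a = (q + column p b a) % p


module Values where
  open import Data.Nat as ℕ using (ℕ; zero; suc; _∸_)
  open import Data.Nat.DivMod using (_/_; _%_; m≡m%n+[m/n]*n)
  open import Data.Integer using (ℤ; +_; 1ℤ; _+_; _-_; _*_; _^_)
  open import Data.Integer.Properties
  open import Data.Integer.Tactic.RingSolver using (solve-∀)
  open import Algebra.Properties.CommutativeSemigroup +-commutativeSemigroup using (interchange)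
  open import Algebra.Properties.CommutativeSemigroup *-commutativeSemigroup using (x∙yz≈y∙xz)
  open Normalisation using (finalCarry; normalDigits; column; columns)
  open ≡-Reasoning

  Σ<-cong : ∀ n {f g : Fin n → ℤ} → (∀ i → f i ≡ g i) → Σ< n f ≡ Σ< n g
  Σ<-cong zero    f≡g = refl
  Σ<-cong (suc n) f≡g = cong₂ _+_ (f≡g zero) (Σ<-cong n (f≡g ∘ suc))

  Σ<-+ : ∀ n (f g : Fin n → ℤ) → Σ< n (λ i → f i + g i) ≡ Σ< n f + Σ< n g
  Σ<-+ zero    f g = refl
  Σ<-+ (suc n) f g = trans (cong (_+_ (f zero + g zero)) (Σ<-+ n (f ∘ suc) (g ∘ suc)))
                           (interchange (f zero) (g zero) _ _)

  Σ<-*ˡ : ∀ n x (f : Fin n → ℤ) → Σ< n (λ i → x * f i) ≡ x * Σ< n f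
  Σ<-*ˡ zero    x f = sym (*-zeroʳ x)
  Σ<-*ˡ (suc n) x f = trans (cong (_+_ (x * f zero)) (Σ<-*ˡ n x (f ∘ suc)))
                            (sym (*-distribˡ-+ x (f zero) _))

  digitsVal-suc : ∀ p s (γ : Fin (suc s) → ℕ) →
                  digitsVal p (suc s) γ ≡ + γ zero + + p * digitsVal p s (γ ∘ suc)
  digitsVal-suc p s γ = cong₂ _+_ (*-identityʳ (+ γ zero))
    (trans (Σ<-cong s (λ i → x∙yz≈y∙xz (+ γ (suc i)) (+ p) _)) (Σ<-*ˡ s (+ p) _))

  digitsVal-max : ∀ m s → digitsVal (suc m) s (λ _ → m) ≡ (+ suc m) ^ s - 1ℤ
  digitsVal-max m zero    = refl
  digitsVal-max m (suc s) = begin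
    digitsVal (suc m) (suc s) (λ _ → m)              ≡⟨ digitsVal-suc (suc m) s (λ _ → m) ⟩
    + m + (1ℤ + + m) * digitsVal (suc m) s (λ _ → m) ≡⟨ cong (λ x → + m + (1ℤ + + m) * x) IH ⟩
    + m + (1ℤ + + m) * ((+ suc m) ^ s - 1ℤ)          ≡⟨ geometric (+ m) ((+ suc m) ^ s) ⟩
    (1ℤ + + m) * (+ suc m) ^ s - 1ℤ                  ∎
    where
    IH : digitsVal (suc m) s (λ _ → m) ≡ (+ suc m) ^ s - 1ℤ
    IH = digitsVal-max m s
    geometric : ∀ x y → x + (1ℤ + x) * (y - 1ℤ) ≡ (1ℤ + x) * y - 1ℤ
    geometric = solve-∀

  normalDigits-value : ∀ p .{{_ : ℕ.NonZero p}} s q (c : Fin s → ℕ) →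
    + q + digitsVal p s c ≡ digitsVal p s (normalDigits p q c) + + finalCarry p q c * (+ p) ^ s
  normalDigits-value p zero q c =
    trans (+-identityʳ (+ q)) (sym (trans (+-identityˡ _) (*-identityʳ (+ q))))
  normalDigits-value p (suc s) q c = begin
    + q + digitsVal p (suc s) c                    ≡⟨ cong (_+_ (+ q)) (digitsVal-suc p s c) ⟩
    + q + (+ c zero + + p * X)                     ≡⟨ sym (+-assoc (+ q) (+ c zero) (+ p * X)) ⟩
    + t + + p * X                                  ≡⟨ cong (λ x → x + + p * X) t≡d+q′p ⟩
    + d + + q′ * + p + + p * X                     ≡⟨ shift (+ d) (+ q′) (+ p) X ⟩
    + d + + p * (+ q′ + X)                         ≡⟨ cong (λ x → + d + + p * x) value′ ⟩
    + d + + p * (digitsVal p s γ′ + + Q * P)       ≡⟨ unshift (+ d) (+ p) _ (+ Q) P ⟩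
    + d + + p * digitsVal p s γ′ + + Q * (+ p * P) ≡⟨ cong (λ x → x + + Q * (+ p * P)) digits≡ ⟩
    digitsVal p (suc s) γ + + Q * (+ p) ^ suc s    ∎
    where
    t d q′ Q : ℕ
    t = q ℕ.+ c zero
    d = t % p
    q′ = t / p
    Q = finalCarry p q′ (c ∘ suc)
    γ : Fin (suc s) → ℕ
    γ = normalDigits p q c
    γ′ : Fin s → ℕ
    γ′ = normalDigits p q′ (c ∘ suc)
    X P : ℤ
    X = digitsVal p s (c ∘ suc)
    P = (+ p) ^ s
    t≡d+q′p : + t ≡ + d + + q′ * + p
    t≡d+q′p = trans (cong +_ (m≡m%n+[m/n]*n t p)) (trans (pos-+ d _) (cong (_+_ (+ d)) (pos-* q′ p)))
    value′ : + q′ + X ≡ digitsVal p s γ′ + + Q * P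
    value′ = normalDigits-value p s q′ (c ∘ suc)
    digits≡ : + d + + p * digitsVal p s γ′ ≡ digitsVal p (suc s) γ
    digits≡ = sym (digitsVal-suc p s γ)
    shift : ∀ d q p x → d + q * p + p * x ≡ d + p * (q + x)
    shift = solve-∀
    unshift : ∀ d p y Q P → d + p * (y + Q * P) ≡ d + p * y + Q * (p * P)
    unshift = solve-∀

  +m-+n≡+[m∸n] : ∀ {m n} → n ℕ.≤ m → + m - + n ≡ + (m ∸ n)
  +m-+n≡+[m∸n] {m} {n} n≤m = trans (m-n≡m⊖n m n) (⊖-≥ n≤m)

  +column : ∀ {m b} a → b ℕ.≤ m → + column (suc m) b a ≡ + 2 * + a - + b + + m
  +column {m} {b} a b≤m = begin
    + (m ∸ b ℕ.+ 2 ℕ.* a)   ≡⟨ pos-+ (m ∸ b) _ ⟩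
    + (m ∸ b) + + (2 ℕ.* a)  ≡⟨ cong₂ _+_ (sym (+m-+n≡+[m∸n] b≤m)) (pos-* 2 a) ⟩
    + m - + b + + 2 * + a    ≡⟨ rearrange (+ m) (+ b) (+ a) ⟩
    + 2 * + a - + b + + m    ∎
    where
    rearrange : ∀ m b a → m - b + + 2 * a ≡ + 2 * a - b + m
    rearrange = solve-∀

  columns-value : ∀ m s (u : Fin (suc s) → ℕ) → (∀ k → u k ℕ.≤ m) →
    digitsVal (suc m) s (columns (suc m) u) ≡ vOf (suc m) s u + digitsVal (suc m) s (λ _ → m)
  columns-value m s u u≤m = trans
    (Σ<-cong s λ i → trans (cong (_* power i) (+column (u (suc i)) (u≤m (inject₁ i))))
                           (*-distribʳ-+ (power i) (+ 2 * + u (suc i) - + u (inject₁ i)) (+ m)))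
    (Σ<-+ s _ _)
    where
    power : Fin s → ℤ
    power i = (+ suc m) ^ toℕ i

  expansion : ∀ m s (u : Fin (suc s) → ℕ) → (∀ k → u k ℕ.≤ m) →
    vOf (suc m) s u + (1ℤ - + finalCarry (suc m) 1 (columns (suc m) u)) * (+ suc m) ^ s
      ≡ digitsVal (suc m) s (normalDigits (suc m) 1 (columns (suc m) u))
  expansion m s u u≤m = begin
    v + (1ℤ - + Q) * P                  ≡⟨ regroup v P (+ Q) ⟩
    1ℤ + (v + (P - 1ℤ)) - + Q * P       ≡⟨ cong (λ x → 1ℤ + x - + Q * P) columns≡ ⟩
    1ℤ + digitsVal p s c - + Q * P      ≡⟨ cong (_- + Q * P) (normalDigits-value p s 1 c) ⟩
    digitsVal p s γ + + Q * P - + Q * P ≡⟨ cancel (digitsVal p s γ) (+ Q * P) ⟩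
    digitsVal p s γ                     ∎
    where
    p : ℕ
    p = suc m
    c γ : Fin s → ℕ
    c = columns p u
    γ = normalDigits p 1 c
    Q : ℕ
    Q = finalCarry p 1 c
    v P : ℤ
    v = vOf p s u
    P = (+ p) ^ s
    columns≡ : v + (P - 1ℤ) ≡ digitsVal p s c
    columns≡ = sym (trans (columns-value m s u u≤m) (cong (_+_ v) (digitsVal-max m s)))
    regroup : ∀ v P Q → v + (1ℤ - Q) * P ≡ 1ℤ + (v + (P - 1ℤ)) - Q * P
    regroup = solve-∀
    cancel : ∀ x y → x + y - y ≡ x
    cancel = solve-∀

  vOf-const : ∀ {m} p s (u : Fin (suc s) → ℕ) → (∀ k → u k ≡ m) →
              vOf p s u ≡ digitsVal p s (λ _ → m)
  vOf-const {m} p s u u≡m = Σ<-cong s λ i → cong (_* (+ p) ^ toℕ i) (begin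
    + 2 * + u (suc i) - + u (inject₁ i) ≡⟨ cong₂ (λ a b → + 2 * + a - + b) (u≡m _) (u≡m _) ⟩
    + 2 * + m - + m                     ≡⟨ 2m-m≡m (+ m) ⟩
    + m                                 ∎)
    where
    2m-m≡m : ∀ m → + 2 * m - m ≡ m
    2m-m≡m = solve-∀

  b+[1-q]+1≡+[2+b∸q] : ∀ b q → q ℕ.≤ 2 ℕ.+ b → + b + (1ℤ - + q) + 1ℤ ≡ + (2 ℕ.+ b ∸ q)
  b+[1-q]+1≡+[2+b∸q] b q q≤2+b = trans (regroup (+ b) (+ q)) (+m-+n≡+[m∸n] q≤2+b)
    where
    regroup : ∀ b q → b + (1ℤ - q) + 1ℤ ≡ + 2 + b - q
    regroup = solve-∀

  sign[1-q] : ∀ {q} → q ℕ.≤ 2 → Sign (1ℤ - + q)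
  sign[1-q] ℕ.z≤n                   = inj₂ (inj₂ refl)
  sign[1-q] (ℕ.s≤s ℕ.z≤n)           = inj₂ (inj₁ refl)
  sign[1-q] (ℕ.s≤s (ℕ.s≤s ℕ.z≤n))   = inj₁ refl

  1-q≡1⇒q≡0 : ∀ {q} → 1ℤ - + q ≡ 1ℤ → q ≡ 0
  1-q≡1⇒q≡0 {q} e = +-injective (trans (sym (1-[1-q]≡q (+ q))) (cong (_-_ 1ℤ) e))
    where
    1-[1-q]≡q : ∀ q → 1ℤ - (1ℤ - q) ≡ q
    1-[1-q]≡q = solve-∀

module CarryStates where
  open import Data.Nat
  open import Data.Nat.Properties
  open import Data.Nat.DivMod
  open import Data.Nat.Primality using (Prime; composite[6])
  open import Data.Nat.Tactic.RingSolver using (solve)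
  open Normalisation

  m*n≤o⇒m≤o/n : ∀ m {n o} .{{_ : NonZero n}} → m * n ≤ o → m ≤ o / n
  m*n≤o⇒m≤o/n m {n} h = subst (_≤ _) (m*n/n≡m m n) (/-monoˡ-≤ n h)

  o/n≡m⇒o%n≡r : ∀ {m n o r} .{{_ : NonZero n}} → o / n ≡ m → o ≡ r + m * n → o % n ≡ r
  o/n≡m⇒o%n≡r {n = n} {o} {r} refl o≡ =
    +-cancelʳ-≡ (o / n * n) (o % n) r (trans (sym (m≡m%n+[m/n]*n o n)) o≡)

  -- Unlike ≤″⇒≤, the hypothesis is a plain _+_ equation, so the ring solver can prove it.
  m+k≡n⇒m≤n : ∀ {m n} k → m + k ≡ n → m ≤ n
  m+k≡n⇒m≤n {m} k refl = m≤m+n m k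

  special? : ∀ p x → Dec (Special p x)
  special? p x = x ≟ 0 ⊎-dec x ≟ 1 ⊎-dec x ≟ p ∸ 2 ⊎-dec x ≟ p ∸ 1

  special⇒≤p∸1 : ∀ {p x} → 2 ≤ p → Special p x → x ≤ p ∸ 1
  special⇒≤p∸1 _           (inj₁ refl)               = z≤n
  special⇒≤p∸1 (s≤s (s≤s _)) (inj₂ (inj₁ refl))      = s≤s z≤n
  special⇒≤p∸1 {p}     _   (inj₂ (inj₂ (inj₁ refl))) = ∸-monoʳ-≤ p (n≤1+n 1)
  special⇒≤p∸1 _           (inj₂ (inj₂ (inj₂ refl))) = ≤-refl

  between⇒¬special : ∀ {p d} → 2 ≤ d → 3 + d ≤ p → ¬ Special p d
  between⇒¬special 2≤d _ (inj₁ refl)        = contradiction 2≤d λ ()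
  between⇒¬special 2≤d _ (inj₂ (inj₁ refl)) = contradiction 2≤d λ { (s≤s ()) }
  between⇒¬special {p} _ 3+d≤p (inj₂ (inj₂ (inj₁ refl))) =
    n≮n (2 + (p ∸ 2)) (≤-trans 3+d≤p (m≤n+m∸n p 2))
  between⇒¬special {p} _ 3+d≤p (inj₂ (inj₂ (inj₂ refl))) =
    n≮n (1 + (p ∸ 1)) (≤-trans (n≤1+n _) (≤-trans 3+d≤p (m≤n+m∸n p 1)))

  column-p∸2 : ∀ m a → column (2 + m) m a ≡ 1 + 2 * a
  column-p∸2 m a = cong (_+ 2 * a) (m+n∸n≡m 1 m)

  column-p∸1 : ∀ m a → column (1 + m) m a ≡ 2 * a
  column-p∸1 m a = cong (_+ 2 * a) (n∸n≡0 m)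

  -- The carries q that can enter the column of the digit b.
  data Admissible (p : ℕ) : ℕ → ℕ → Set where
    at-0   : ∀ {q} → q ≤ 1 → Admissible p q 0
    at-1   : ∀ {q} → q ≤ 2 → Admissible p q 1
    at-p∸2 : ∀ {q} → 1 ≤ q → q ≤ 2 → Admissible p q (p ∸ 2)
    at-p∸1 : ∀ {q} → 1 ≤ q → q ≤ 2 → Admissible p q (p ∸ 1)

  carry≤2 : ∀ {p q b} → Admissible p q b → q ≤ 2
  carry≤2 (at-0 q≤1)     = ≤-trans q≤1 (n≤1+n 1)
  carry≤2 (at-1 q≤2)     = q≤2
  carry≤2 (at-p∸2 _ q≤2) = q≤2
  carry≤2 (at-p∸1 _ q≤2) = q≤2

  admissible-carry-1 : ∀ {p b} → Special p b → Admissible p 1 b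
  admissible-carry-1 (inj₁ refl)               = at-0 ≤-refl
  admissible-carry-1 (inj₂ (inj₁ refl))        = at-1 (n≤1+n 1)
  admissible-carry-1 (inj₂ (inj₂ (inj₁ refl))) = at-p∸2 ≤-refl (n≤1+n 1)
  admissible-carry-1 (inj₂ (inj₂ (inj₂ refl))) = at-p∸1 ≤-refl (n≤1+n 1)

  module Radix≥4 (n : ℕ) where

    p : ℕ
    p = 4 + n

    carry-in+column≤ : ∀ {q b a} → q ≤ 2 → q + column p b a ≤ 2 + (3 + n + 2 * a)
    carry-in+column≤ {b = b} {a} q≤2 = +-mono-≤ q≤2 (+-monoˡ-≤ (2 * a) (m∸n≤m (3 + n) b))

    nextCarry<3 : ∀ {q b a} → q ≤ 2 → a ≤ p ∸ 1 → nextCarry p q b a < 3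
    nextCarry<3 {q} {b} {a} q≤2 a≤p∸1 = m<n*o⇒m/o<n (begin-strict
      q + column p b a          ≤⟨ carry-in+column≤ {q} {b} {a} q≤2 ⟩
      2 + (3 + n + 2 * a)       ≤⟨ +-monoʳ-≤ 2 (+-monoʳ-≤ (3 + n) (*-monoʳ-≤ 2 a≤p∸1)) ⟩
      2 + (3 + n + 2 * (3 + n)) <⟨ ≤-reflexive (solve (n ∷ [])) ⟩
      3 * (4 + n)               ∎)
      where open ≤-Reasoning

    nextCarry<2 : ∀ {q b} → q ≤ 2 → nextCarry p q b 0 < 2
    nextCarry<2 {q} {b} q≤2 = m<n*o⇒m/o<n (begin-strict
      q + column p b 0  ≤⟨ carry-in+column≤ {q} {b} {0} q≤2 ⟩
      2 + (3 + n + 0)   <⟨ m+k≡n⇒m≤n (2 + n) (solve (n ∷ [])) ⟩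
      2 * (4 + n)       ∎)
      where open ≤-Reasoning

    1≤nextCarry : ∀ {q b a} → p ∸ 2 ≤ a → 1 ≤ nextCarry p q b a
    1≤nextCarry {q} {b} {a} p∸2≤a = m≥n⇒m/n>0 (begin
      4 + n                  ≤⟨ m+k≡n⇒m≤n n (solve (n ∷ [])) ⟩
      2 * (2 + n)            ≤⟨ *-monoʳ-≤ 2 p∸2≤a ⟩
      2 * a                  ≤⟨ m≤n+m (2 * a) (p ∸ 1 ∸ b) ⟩
      column p b a           ≤⟨ m≤n+m (column p b a) q ⟩
      q + column p b a       ∎)
      where open ≤-Reasoning

    admissible-step : ∀ {q b a} → q ≤ 2 → Special p a → Admissible p (nextCarry p q b a) a
    admissible-step {q} {b} q≤2 (inj₁ refl) = at-0 (≤-pred (nextCarry<2 {q} {b} q≤2))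
    admissible-step {q} {b} q≤2 (inj₂ (inj₁ refl)) =
      at-1 (≤-pred (nextCarry<3 {q} {b} q≤2 (s≤s z≤n)))
    admissible-step {q} {b} q≤2 (inj₂ (inj₂ (inj₁ refl))) =
      at-p∸2 (1≤nextCarry {q} {b} ≤-refl) (≤-pred (nextCarry<3 {q} {b} q≤2 (n≤1+n _)))
    admissible-step {q} {b} q≤2 (inj₂ (inj₂ (inj₂ refl))) =
      at-p∸1 (1≤nextCarry {q} {b} (n≤1+n _)) (≤-pred (nextCarry<3 {q} {b} q≤2 ≤-refl))

    2≤nextCarry-at-top : ∀ {q b} → 2 ≤ q + (p ∸ 1 ∸ b) → 2 ≤ nextCarry p q b (p ∸ 1)
    2≤nextCarry-at-top {q} {b} 2≤ = m*n≤o⇒m≤o/n 2 (begin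
      2 * (4 + n)                    ≡⟨ solve (n ∷ []) ⟩
      2 + 2 * (3 + n)                ≤⟨ +-monoˡ-≤ (2 * (3 + n)) 2≤ ⟩
      q + (p ∸ 1 ∸ b) + 2 * (3 + n)  ≡⟨ +-assoc q _ _ ⟩
      q + column p b (p ∸ 1)         ∎)
      where open ≤-Reasoning

    top-predecessor : ∀ {q b} → Admissible p q b → nextCarry p q b (p ∸ 1) ≡ 1 →
                      q ≡ 1 × b ≡ p ∸ 1
    top-predecessor {q} (at-0 _) c≡1 = contradiction c≡1 (>⇒≢
      (2≤nextCarry-at-top {q} {0} (≤-trans (m≤m+n 2 (1 + n)) (m≤n+m _ q))))
    top-predecessor {q} (at-1 _) c≡1 = contradiction c≡1 (>⇒≢
      (2≤nextCarry-at-top {q} {1} (≤-trans (m≤m+n 2 n) (m≤n+m _ q))))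
    top-predecessor {q} (at-p∸2 1≤q _) c≡1 = contradiction c≡1 (>⇒≢
      (2≤nextCarry-at-top {q} {p ∸ 2} (+-mono-≤ 1≤q (m<n⇒0<n∸m (n<1+n n)))))
    top-predecessor (at-p∸1 _ (s≤s z≤n)) c≡1 = refl , refl
    top-predecessor (at-p∸1 _ (s≤s (s≤s z≤n))) c≡1 = contradiction c≡1 (>⇒≢
      (2≤nextCarry-at-top {2} {p ∸ 1} (m≤m+n 2 _)))

    admissible-final : ∀ {s q} (u : Fin (suc s) → ℕ) → (∀ k → Special p (u k)) →
                       Admissible p q (u zero) → Admissible p (finalCarry p q (columns p u)) (u (fromℕ s))
    admissible-final {zero}  u special adm = adm
    admissible-final {suc s} {q} u special adm =
      admissible-final (u ∘ suc) (special ∘ suc)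
        (admissible-step {q} {u zero} (carry≤2 adm) (special (suc zero)))

    top-at-end⇒top-throughout : ∀ {s q} (u : Fin (suc s) → ℕ) → (∀ k → Special p (u k)) →
                                Admissible p q (u zero) → finalCarry p q (columns p u) ≡ 1 →
                                u (fromℕ s) ≡ p ∸ 1 → q ≡ 1 × (∀ k → u k ≡ p ∸ 1)
    top-at-end⇒top-throughout {zero} u _ _ q≡1 top = q≡1 , λ { zero → top ; (suc ()) }
    top-at-end⇒top-throughout {suc s} {q} u special adm Q≡1 top
      with top-at-end⇒top-throughout (u ∘ suc) (special ∘ suc)
             (admissible-step {q} {u zero} (carry≤2 adm) (special (suc zero))) Q≡1 top
    ... | q′≡1 , u′≡
      with top-predecessor adm (subst (λ a → nextCarry p q (u zero) a ≡ 1) (u′≡ zero) q′≡1)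
    ...   | q≡1 , u₀≡ = q≡1 , λ { zero → u₀≡ ; (suc k) → u′≡ k }

    -- For δ = 1 - q, 2 + b ∸ q is the value u s + δ + 1 bounded in the theorem.
    top-digit-bounds : ∀ {q b} → Admissible p q b → ¬ (q ≡ 1 × b ≡ p ∸ 1) →
                       1 ≤ 2 + b ∸ q × 2 + b ∸ q ≤ p ∸ 1
    top-digit-bounds (at-0 z≤n)                    _   = s≤s z≤n , s≤s (s≤s z≤n)
    top-digit-bounds (at-0 (s≤s z≤n))              _   = s≤s z≤n , s≤s z≤n
    top-digit-bounds (at-1 z≤n)                    _   = s≤s z≤n , s≤s (s≤s (s≤s z≤n))
    top-digit-bounds (at-1 (s≤s z≤n))              _   = s≤s z≤n , s≤s (s≤s z≤n)
    top-digit-bounds (at-1 (s≤s (s≤s z≤n)))        _   = s≤s z≤n , s≤s z≤n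
    top-digit-bounds (at-p∸2 _ (s≤s z≤n))          _   = s≤s z≤n , ≤-refl
    top-digit-bounds (at-p∸2 _ (s≤s (s≤s z≤n)))    _   = s≤s z≤n , n≤1+n _
    top-digit-bounds (at-p∸1 _ (s≤s z≤n))          top = contradiction (refl , refl) top
    top-digit-bounds (at-p∸1 _ (s≤s (s≤s z≤n)))    _   = s≤s z≤n , ≤-refl

  -- For p ≥ 7: states that cannot be reached while every digit produced is special.
  Forbidden : ℕ → ℕ → ℕ → Set
  Forbidden p q b = q ≡ 0 × b ≡ 1 ⊎ q ≡ 2 × b ≡ p ∸ 2

  module Radix≥7 (n : ℕ) where

    p : ℕ
    p = 7 + n

    open Radix≥4 (3 + n) using (admissible-step)

    ¬special : ∀ {d} → 2 ≤ d → d ≤ 4 + n → ¬ Special p d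
    ¬special 2≤d d≤4+n = between⇒¬special 2≤d (+-monoʳ-≤ 3 d≤4+n)

    ¬special-p∸5+ : ∀ {q} → q ≤ 1 → ¬ Special p (q + (2 + n))
    ¬special-p∸5+ {q} q≤1 =
      ¬special (≤-trans (m≤m+n 2 n) (m≤n+m _ q)) (+-monoˡ-≤ (2 + n) (≤-trans q≤1 (n≤1+n 1)))

    into-0-1 : ∀ {q b} → Admissible p q b → nextCarry p q b 1 ≡ 0 →
               Special p (nextDigit p q b 1) → Forbidden p q b
    into-0-1 {q} {b} adm c≡0 sp = go adm
      where
      open ≤-Reasoning
      t<p : q + column p b 1 < p
      t<p = m/n≡0⇒m<n c≡0
      digit≡ : nextDigit p q b 1 ≡ q + column p b 1
      digit≡ = m<n⇒m%n≡m t<p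
      go : Admissible p q b → Forbidden p q b
      go (at-0 _) = contradiction t<p (≤⇒≯ (begin
        7 + n            ≤⟨ m+k≡n⇒m≤n 1 (solve (n ∷ [])) ⟩
        6 + n + 2 * 1    ≤⟨ m≤n+m _ q ⟩
        q + column p 0 1 ∎))
      go (at-1 _) = contradiction t<p (≤⇒≯ (begin
        7 + n            ≤⟨ m+k≡n⇒m≤n 0 (solve (n ∷ [])) ⟩
        5 + n + 2 * 1    ≤⟨ m≤n+m _ q ⟩
        q + column p 1 1 ∎))
      go (at-p∸2 _ (s≤s z≤n)) = contradiction
        (subst (Special p) (trans digit≡ (cong (1 +_) (column-p∸2 (5 + n) 1))) sp)
        (¬special (s≤s (s≤s z≤n)) (m≤m+n 4 n))
      go (at-p∸2 _ (s≤s (s≤s z≤n))) = inj₂ (refl , refl)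
      go (at-p∸1 _ (s≤s z≤n)) = contradiction
        (subst (Special p) (trans digit≡ (cong (1 +_) (column-p∸1 (6 + n) 1))) sp)
        (¬special (s≤s (s≤s z≤n)) (m≤m+n 3 (1 + n)))
      go (at-p∸1 _ (s≤s (s≤s z≤n))) = contradiction
        (subst (Special p) (trans digit≡ (cong (2 +_) (column-p∸1 (6 + n) 1))) sp)
        (¬special (s≤s (s≤s z≤n)) (m≤m+n 4 n))

    into-2-p∸2 : ∀ {q b} → Admissible p q b → nextCarry p q b (p ∸ 2) ≡ 2 →
                 Special p (nextDigit p q b (p ∸ 2)) → Forbidden p q b
    into-2-p∸2 {q} {b} adm c≡2 sp = go adm
      where
      open ≤-Reasoning
      digit≡ : ∀ {r} → q + column p b (p ∸ 2) ≡ r + 2 * p → nextDigit p q b (p ∸ 2) ≡ r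
      digit≡ = o/n≡m⇒o%n≡r c≡2
      carry<2 : q ≤ 2 → q + column p b (p ∸ 2) ≤ 1 + q + 2 * (5 + n) → nextCarry p q b (p ∸ 2) < 2
      carry<2 q≤2 t≤ = m<n*o⇒m/o<n (begin-strict
        q + column p b (p ∸ 2)  ≤⟨ t≤ ⟩
        1 + q + 2 * (5 + n)     ≤⟨ +-monoˡ-≤ (2 * (5 + n)) (s≤s q≤2) ⟩
        3 + 2 * (5 + n)         <⟨ m+k≡n⇒m≤n 0 (solve (n ∷ [])) ⟩
        2 * (7 + n)             ∎)
      go : Admissible p q b → Forbidden p q b
      go (at-0 q≤1) = contradiction (subst (Special p) (digit≡ (begin-equality
        q + column p 0 (p ∸ 2)     ≡⟨⟩
        q + (6 + n + 2 * (5 + n))  ≡⟨ solve (q ∷ n ∷ []) ⟩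
        q + (2 + n) + 2 * (7 + n)  ∎)) sp) (¬special-p∸5+ q≤1)
      go (at-1 z≤n) = inj₁ (refl , refl)
      go (at-1 {suc q′} (s≤s q′≤1)) = contradiction (subst (Special p) (digit≡ (begin-equality
        suc q′ + column p 1 (p ∸ 2)     ≡⟨⟩
        suc q′ + (5 + n + 2 * (5 + n))  ≡⟨ solve (q′ ∷ n ∷ []) ⟩
        q′ + (2 + n) + 2 * (7 + n)      ∎)) sp) (¬special-p∸5+ q′≤1)
      go (at-p∸2 _ q≤2) = contradiction c≡2 (<⇒≢ (carry<2 q≤2 (≤-reflexive (trans
        (cong (q +_) (column-p∸2 (5 + n) (5 + n))) (+-suc q _)))))
      go (at-p∸1 _ q≤2) = contradiction c≡2 (<⇒≢ (carry<2 q≤2 (≤-trans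
        (≤-reflexive (cong (q +_) (column-p∸1 (6 + n) (5 + n)))) (+-monoˡ-≤ _ (n≤1+n q)))))

    forbidden-predecessor : ∀ {q b a} → Admissible p q b → Special p (nextDigit p q b a) →
                            Forbidden p (nextCarry p q b a) a → Forbidden p q b
    forbidden-predecessor adm sp (inj₁ (c≡0 , refl)) = into-0-1 adm c≡0 sp
    forbidden-predecessor adm sp (inj₂ (c≡2 , refl)) = into-2-p∸2 adm c≡2 sp

    forbidden-at-end⇒¬special-digit :
      ∀ {s q} (u : Fin (suc s) → ℕ) → (∀ k → Special p (u k)) → Admissible p q (u zero) →
      ¬ Forbidden p q (u zero) → Forbidden p (finalCarry p q (columns p u)) (u (fromℕ s)) →
      ∃ λ i → ¬ Special p (normalDigits p q (columns p u) i)
    forbidden-at-end⇒¬special-digit {zero} u _ _ ¬forbidden forbidden = contradiction forbidden ¬forbidden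
    forbidden-at-end⇒¬special-digit {suc s} {q} u special adm ¬forbidden forbidden
      with special? p (nextDigit p q (u zero) (u (suc zero)))
    ... | no ¬sp = zero , ¬sp
    ... | yes sp with forbidden-at-end⇒¬special-digit (u ∘ suc) (special ∘ suc)
                        (admissible-step {q} {u zero} (carry≤2 adm) (special (suc zero)))
                        (¬forbidden ∘ forbidden-predecessor adm sp) forbidden
    ...   | i , ¬sp = suc i , ¬sp

  prime>5⇒7≤p : ∀ {p} → Prime p → p > 5 → 7 ≤ p
  prime>5⇒7≤p p-prime p>5 = ≤∧≢⇒< p>5 λ { refl → Prime.notComposite p-prime composite[6] }

  7≤p⇒¬special-digit : ∀ {p s} .{{_ : NonZero p}} → 7 ≤ p →
                       (u : Fin (suc s) → ℕ) → (∀ k → Special p (u k)) →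
                       finalCarry p 1 (columns p u) ≡ 0 → u (fromℕ s) ≡ 1 →
                       ∃ λ i → ¬ Special p (normalDigits p 1 (columns p u) i)
  7≤p⇒¬special-digit (s≤s (s≤s (s≤s (s≤s (s≤s (s≤s (s≤s {n = n} z≤n))))))) u special Q≡0 u≡1 =
    Radix≥7.forbidden-at-end⇒¬special-digit n u special (admissible-carry-1 (special zero))
      (λ { (inj₁ (() , _)) ; (inj₂ (() , _)) }) (inj₁ (Q≡0 , u≡1))

open Normalisation
open Values
open CarryStates
open import Data.Nat as ℕ using (ℕ; suc; _>_)
open import Data.Nat using (z≤n; s≤s)
open import Data.Nat.Properties using (≤-trans; m≤m+n)
open import Data.Nat.Primality using (Prime)
open import Data.Integer as ℤ using (ℤ; +_; _+_; _*_; _^_; 1ℤ; +<+; +≤+)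
open import Data.Product using (Σ; proj₁; proj₂)

lemma8 : (p s : ℕ) → Prime p → p > 3 → s ℕ.> 0
    → (u : Fin (suc s) → ℕ) → (∀ k → Special p (u k))
    → vOf p s u ≢ (+ p) ^ s ℤ.- + 1
    → Σ ℤ λ δ → Σ (Fin s → ℕ) λ γ →
        Sign δ
        × vOf p s u + δ * (+ p) ^ s ≡ digitsVal p s γ
        × (∀ i → γ i ℕ.< p)
        × + 0 ℤ.< + u (fromℕ s) + δ + + 1
        × + u (fromℕ s) + δ + + 1 ℤ.≤ + (p ℕ.∸ 1)
        × (u (fromℕ s) ≡ 1 → δ ≡ + 1 → p > 5 → ∃ λ i → ¬ Special p (γ i))
lemma8 p s p-prime (s≤s (s≤s (s≤s (s≤s {n = n} z≤n)))) _ u special v≢ =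
  δ , normalDigits p 1 c
  , sign[1-q] (carry≤2 final)
  , expansion (3 ℕ.+ n) s u (λ k → special⇒≤p∸1 (s≤s (s≤s z≤n)) (special k))
  , normalDigits<p p 1 c
  , subst (+ 0 ℤ.<_) (sym top≡) (+<+ (proj₁ (top-digit-bounds final not-top)))
  , subst (ℤ._≤ + (p ℕ.∸ 1)) (sym top≡) (+≤+ (proj₂ (top-digit-bounds final not-top)))
  , λ u≡1 δ≡1 p>5 →
      7≤p⇒¬special-digit (prime>5⇒7≤p p-prime p>5) u special (1-q≡1⇒q≡0 δ≡1) u≡1
  where
  open Radix≥4 n using (admissible-final; top-at-end⇒top-throughout; top-digit-bounds)
  c : Fin s → ℕ
  c = columns p u
  Q : ℕ
  Q = finalCarry p 1 c
  δ : ℤ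
  δ = 1ℤ ℤ.- + Q
  initial : Admissible p 1 (u zero)
  initial = admissible-carry-1 (special zero)
  final : Admissible p Q (u (fromℕ s))
  final = admissible-final u special initial
  not-top : ¬ (Q ≡ 1 × u (fromℕ s) ≡ p ℕ.∸ 1)
  not-top (Q≡1 , top) = v≢ (trans
    (vOf-const p s u (proj₂ (top-at-end⇒top-throughout u special initial Q≡1 top)))
    (digitsVal-max (3 ℕ.+ n) s))
  top≡ : + u (fromℕ s) + δ + + 1 ≡ + (2 ℕ.+ u (fromℕ s) ℕ.∸ Q)
  top≡ = b+[1-q]+1≡+[2+b∸q] (u (fromℕ s)) Q (≤-trans (carry≤2 final) (m≤m+n 2 _))
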